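{- For every BL-algebra $L$, the element $u_L=[(1),(0)]$ is a strong unit of the $\ell$-group $(G_L,\preceq)$, i.e. $u_L\succeq 0$ and for every $x\in G_L$ there is an integer $n\ge1$ with $x\preceq nu_L$.
   Context: A BL-algebra is an algebra $(L,\wedge,\vee,\otimes,\to,0,1)$ such that $(L,\wedge,\vee,0,1)$ is a bounded lattice, $(L,\otimes,1)$ is a commutative monoid, $x\otimes y\le z$ iff $x\le y\to z$, $x\wedge y=x\otimes(x\to y)$, and $(x\to y)\vee(y\to x)=1$. Put $\bar x=x\to0$, $x\oslash y=\bar x\to y$, $x+y=(x\oslash y)\wedge(y\oslash x)$. A good sequence is a sequence $(a_1,a_2,\ldots)$ in $L$ with $a_i+a_{i+1}=a_i$ for all $i$ and $a_r=0$ for large $r$; $(a_1,\dots,a_n)$ abbreviates $(a_1,\dots,a_n,0,0,\dots)$. Sum: $(\mathbf{a}+\mathbf{b})_i=a_i+(a_{i-1}\otimes b_1)+\cdots+(a_1\otimes b_{i-1})+b_i$. $M_L$ is the commutative monoid of good sequences, ordered componentwise. The Chang group $G_L=(M_L\times M_L)/\sim$ where $(\mathbf{a},\mathbf{b})\sim(\mathbf{c},\mathbf{d})$ iff $\mathbf{a}+\mathbf{d}+\mathbf{k}=\mathbf{b}+\mathbf{c}+\mathbf{k}$ for some $\mathbf{k}\in M_L$; classes $[\mathbf{a},\mathbf{b}]$, addition componentwise, order $[\mathbf{a},\mathbf{b}]\preceq[\mathbf{c},\mathbf{d}]$ iff $\mathbf{a}+\mathbf{d}+\mathbf{k}\le\mathbf{b}+\mathbf{c}+\mathbf{k}$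 for some $\mathbf{k}\in M_L$; $(G_L,\preceq)$ is a lattice-ordered Abelian group. -}

module Defs where

open import Level using (Level)
open import Data.Nat as ℕ using (ℕ; zero; suc; _∸_)
open import Data.Product using (Σ; ∃; _×_; _,_)
open import Relation.Binary.PropositionalEquality using (_≡_)
import Algebra.Lattice.Structures as LS
import Algebra.Structures as AS

record BLAlgebra (c : Level) : Set (Level.suc c) where
  infixr 7 _⊗_
  infixr 5 _⇒_
  infixr 6 _∧_
  infixr 6 _∨_
  field
    Carrier : Set c
    _∧_ _∨_ _⊗_ _⇒_ : Carrier → Carrier → Carrier
    𝟎 𝟏 : Carrier
    isLattice : LS.IsLattice (_≡_ {A = Carrier}) _∨_ _∧_
    𝟎-bottom : ∀ x → 𝟎 ∧ x ≡ 𝟎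
    𝟏-top : ∀ x → x ∧ 𝟏 ≡ x
    isCommutativeMonoid : AS.IsCommutativeMonoid (_≡_ {A = Carrier}) _⊗_ 𝟏

  _≤_ : Carrier → Carrier → Set c
  x ≤ y = x ∧ y ≡ x

  field
    residuation : ∀ x y z → ((x ⊗ y) ≤ z → x ≤ (y ⇒ z)) × (x ≤ (y ⇒ z) → (x ⊗ y) ≤ z)
    divisibility : ∀ x y → x ∧ y ≡ x ⊗ (x ⇒ y)
    prelinearity : ∀ x y → (x ⇒ y) ∨ (y ⇒ x) ≡ 𝟏

  ‾ : Carrier → Carrier
  ‾ x = x ⇒ 𝟎

  _⊘_ : Carrier → Carrier → Carrier
  x ⊘ y = ‾ x ⇒ y

  infixl 6 _⊕_
  _⊕_ : Carrier → Carrier → Carrier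
  x ⊕ y = (x ⊘ y) ∧ (y ⊘ x)

module Chang {c : Level} (L : BLAlgebra c) where
  open BLAlgebra L

  -- A sequence (a₁, a₂, …) is represented by  a : ℕ → Carrier  with
  -- a i = a_{i+1} (0-based storage of the paper's 1-based sequence).
  Seq : Set c
  Seq = ℕ → Carrier

  record GoodSeq : Set c where
    constructor goodSeq
    field
      seq  : Seq
      good : ∀ i → seq i ⊕ seq (suc i) ≡ seq i
      fin  : ∃ λ r → ∀ i → r ℕ.≤ i → seq i ≡ 𝟎
  open GoodSeq public

  -- (a_0 := 1, a_1, a_2, …) in 1-based indexing
  ext : Seq → ℕ → Carrier
  ext a zero    = 𝟏
  ext a (suc i) = a i

  sumUpTo : (ℕ → Carrier) → ℕ → Carrier
  sumUpTo t zero    = t zero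
  sumUpTo t (suc k) = sumUpTo t k ⊕ t (suc k)

  -- (a + b)_n = a_n + (a_{n-1} ⊗ b_1) + ⋯ + (a_1 ⊗ b_{n-1}) + b_n
  -- (terms a_n ⊗ 1 and 1 ⊗ b_n at the two ends, equal to a_n and b_n)
  infixl 6 _+ˢ_
  _+ˢ_ : Seq → Seq → Seq
  (a +ˢ b) i = sumUpTo (λ j → ext a (suc i ∸ j) ⊗ ext b j) (suc i)

  zeroˢ : Seq
  zeroˢ _ = 𝟎

  oneˢ : Seq
  oneˢ zero    = 𝟏
  oneˢ (suc _) = 𝟎

  _≤ˢ_ : Seq → Seq → Set c
  a ≤ˢ b = ∀ i → a i ≤ b i

  -- elements of G_L are represented by pairs of good sequences;
  -- a pair (a , b) stands for the class [a , b]
  G : Set c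
  G = GoodSeq × GoodSeq

  -- raw pairs of sequences (used to compute multiples of u_L)
  RawPair : Set c
  RawPair = Seq × Seq

  _+ᴾ_ : RawPair → RawPair → RawPair
  (a , b) +ᴾ (c' , d) = (a +ˢ c') , (b +ˢ d)

  _≼_ : RawPair → RawPair → Set c
  (a , b) ≼ (c' , d) = Σ GoodSeq λ k → ((a +ˢ d) +ˢ seq k) ≤ˢ ((b +ˢ c') +ˢ seq k)

  ⌊_⌋ : G → RawPair
  ⌊ (a , b) ⌋ = seq a , seq b

  u : RawPair
  u = oneˢ , zeroˢ

  0ᴳ : RawPair
  0ᴳ = zeroˢ , zeroˢ

  -- n · x  for n ≥ 1 (1 · x = x, (n+1) · x = n · x + x)
  _·ᴾ_ : ℕ → RawPair → RawPair
  zero        ·ᴾ x = x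
  suc zero    ·ᴾ x = x
  suc (suc n) ·ᴾ x = (suc n ·ᴾ x) +ᴾ x

  IsStrongUnit : RawPair → Set c
  IsStrongUnit v = (0ᴳ ≼ v) × (∀ (x : G) → ∃ λ n → (1 ℕ.≤ n) × (⌊ x ⌋ ≼ (n ·ᴾ v)))

module Submission where

-- Both halves reduce to a single comparison principle for sequences: if X
-- vanishes from index s on and Y equals 1 at every index below n ≥ s, then
-- X ≤ Y componentwise (below s use x ≤ 1, from s on use 0 ≤ y).  Every
-- comparison a + d + k ≤ b + c + k needed here is proved with k = (0), so it
-- remains to know where the relevant sums vanish and where they equal 1:
--   * a sum of sequences vanishing from s and from t vanishes from s + t;
--   * the sum X + Y equals 1 at index i as soon as one of its summands
--     ext X a ⊗ ext Y b (a + b = i + 1) equals 1, in particular wherever X or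
--     Y equals 1;
--   * n·u_L = [(1,…,1), (0)] with n ones.
-- Then 0 ≼ u_L is the case s = n = 0, and for x = [a, b] with a vanishing
-- from r we get x ≼ (r+1)·u_L, since a + (0) + (0) vanishes from r while
-- b + (1,…,1) + (0) is 1 below r + 1.
-- The file first collects the elementary BL-algebra identities involving
-- 0 and 1, then the facts about finite sums ⊕, then the facts above.

open import Defs
open import Level using (Level)
open import Data.Nat as ℕ using (ℕ; zero; suc; _∸_; _+_; _<_; z≤n; s≤s; _≤?_)
open import Data.Nat.Properties
  using (≤-refl; ≤-trans; ≤-reflexive; <-≤-trans; ≰⇒>; n≤1+n; m≤n+m;
         +-monoʳ-≤; +-identityʳ; +-comm; m+n∸n≡m; m+n≤o⇒m≤o∸n; m≤n⇒m<n∨m≡n)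
open import Data.Product using (∃; _×_; _,_; proj₁; proj₂)
open import Data.Sum using (inj₁; inj₂)
open import Relation.Nullary using (yes; no)
open import Relation.Binary.PropositionalEquality
import Algebra.Lattice.Structures as LS
import Algebra.Structures as AS

module StrongUnit {c : Level} (L : BLAlgebra c) where
  open BLAlgebra L
  open Chang L
  open LS.IsLattice isLattice using (∧-comm; absorptive)
  open AS.IsCommutativeMonoid isCommutativeMonoid using (identityˡ; comm)

  ∧-idem : ∀ x → x ∧ x ≡ x
  ∧-idem x = trans (cong (x ∧_) (sym (proj₁ absorptive x x)))
                   (proj₂ absorptive x (x ∧ x))

  ≤𝟎⇒≡𝟎 : ∀ {x} → x ≤ 𝟎 → x ≡ 𝟎
  ≤𝟎⇒≡𝟎 {x} x≤0 = trans (sym x≤0) (trans (∧-comm x 𝟎) (𝟎-bottom x))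

  𝟏≤⇒≡𝟏 : ∀ {x} → 𝟏 ≤ x → x ≡ 𝟏
  𝟏≤⇒≡𝟏 {x} 1≤x = trans (sym (𝟏-top x)) (trans (∧-comm x 𝟏) 1≤x)

  𝟎⊗ : ∀ x → 𝟎 ⊗ x ≡ 𝟎
  𝟎⊗ x = ≤𝟎⇒≡𝟎 (proj₂ (residuation 𝟎 x 𝟎) (𝟎-bottom _))

  ⊗𝟎 : ∀ x → x ⊗ 𝟎 ≡ 𝟎
  ⊗𝟎 x = trans (comm x 𝟎) (𝟎⊗ x)

  𝟎⇒ : ∀ y → 𝟎 ⇒ y ≡ 𝟏
  𝟎⇒ y = 𝟏≤⇒≡𝟏 (proj₁ (residuation 𝟏 𝟎 y)
                   (subst (_≤ y) (sym (identityˡ 𝟎)) (𝟎-bottom y)))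

  ⇒𝟏 : ∀ y → y ⇒ 𝟏 ≡ 𝟏
  ⇒𝟏 y = 𝟏≤⇒≡𝟏 (proj₁ (residuation 𝟏 y 𝟏) (𝟏-top _))

  -- ‾1 = 0: from (1 ⇒ 0) ≤ (1 ⇒ 0) residuation gives (1 ⇒ 0) ⊗ 1 ≤ 0.
  ‾𝟏 : ‾ 𝟏 ≡ 𝟎
  ‾𝟏 = ≤𝟎⇒≡𝟎 (subst (_≤ 𝟎) (trans (comm _ 𝟏) (identityˡ _))
                 (proj₂ (residuation (‾ 𝟏) 𝟏 𝟎) (∧-idem _)))

  𝟏⊘ : ∀ x → 𝟏 ⊘ x ≡ 𝟏
  𝟏⊘ x = trans (cong (_⇒ x) ‾𝟏) (𝟎⇒ x)

  ⊕𝟏 : ∀ x → x ⊕ 𝟏 ≡ 𝟏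
  ⊕𝟏 x = trans (cong₂ _∧_ (⇒𝟏 _) (𝟏⊘ x)) (∧-idem 𝟏)

  𝟏⊕ : ∀ x → 𝟏 ⊕ x ≡ 𝟏
  𝟏⊕ x = trans (cong₂ _∧_ (𝟏⊘ x) (⇒𝟏 _)) (∧-idem 𝟏)

  𝟎⊕𝟎 : 𝟎 ⊕ 𝟎 ≡ 𝟎
  𝟎⊕𝟎 = trans (cong₂ _∧_ ‾‾𝟎 ‾‾𝟎) (∧-idem 𝟎)
    where
    ‾‾𝟎 : ‾ (‾ 𝟎) ≡ 𝟎
    ‾‾𝟎 = trans (cong ‾ (𝟎⇒ 𝟎)) ‾𝟏

  sumUpTo-𝟏 : ∀ (t : ℕ → Carrier) k j → j ℕ.≤ k → t j ≡ 𝟏 → sumUpTo t k ≡ 𝟏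
  sumUpTo-𝟏 t zero .zero z≤n tj≡1 = tj≡1
  sumUpTo-𝟏 t (suc k) j j≤1+k tj≡1 with m≤n⇒m<n∨m≡n j≤1+k
  ... | inj₂ refl      = trans (cong (sumUpTo t k ⊕_) tj≡1) (⊕𝟏 _)
  ... | inj₁ (s≤s j≤k) = trans (cong (_⊕ t (suc k)) (sumUpTo-𝟏 t k j j≤k tj≡1)) (𝟏⊕ _)

  sumUpTo-𝟎 : ∀ (t : ℕ → Carrier) k → (∀ j → j ℕ.≤ k → t j ≡ 𝟎) → sumUpTo t k ≡ 𝟎
  sumUpTo-𝟎 t zero    t≡0 = t≡0 zero z≤n
  sumUpTo-𝟎 t (suc k) t≡0 =
    trans (cong₂ _⊕_ (sumUpTo-𝟎 t k (λ j j≤k → t≡0 j (≤-trans j≤k (n≤1+n k))))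
                     (t≡0 (suc k) ≤-refl))
          𝟎⊕𝟎

  VanishesFrom : Seq → ℕ → Set c
  VanishesFrom X s = ∀ i → s ℕ.≤ i → X i ≡ 𝟎

  OneBelow : Seq → ℕ → Set c
  OneBelow Y n = ∀ i → i < n → Y i ≡ 𝟏

  vanishing≤ˢone : ∀ {X Y s n} → VanishesFrom X s → OneBelow Y n → s ℕ.≤ n → X ≤ˢ Y
  vanishing≤ˢone {X} {Y} {s} X≡0 Y≡1 s≤n i with s ≤? i
  ... | yes s≤i = subst (_≤ Y i) (sym (X≡0 i s≤i)) (𝟎-bottom (Y i))
  ... | no  s≰i = subst (X i ≤_) (sym (Y≡1 i (<-≤-trans (≰⇒> s≰i) s≤n))) (𝟏-top (X i))

  zeroˢ-vanishes : VanishesFrom zeroˢ 0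
  zeroˢ-vanishes _ _ = refl

  ext-vanishes : ∀ {X s} → VanishesFrom X s → VanishesFrom (ext X) (suc s)
  ext-vanishes X≡0 (suc m) (s≤s s≤m) = X≡0 m s≤m

  -- Every summand of (X + Y)_i is 0 once i ≥ s + t: in ext X (i+1-j) ⊗ ext Y j
  -- either j > t, or i + 1 - j ≥ s + 1.
  +ˢ-vanishes : ∀ {X Y s t} → VanishesFrom X s → VanishesFrom Y t →
                VanishesFrom (X +ˢ Y) (s + t)
  +ˢ-vanishes {X} {Y} {s} {t} X≡0 Y≡0 i s+t≤i = sumUpTo-𝟎 _ (suc i) summand≡0
    where
    summand≡0 : ∀ j → j ℕ.≤ suc i → ext X (suc i ∸ j) ⊗ ext Y j ≡ 𝟎
    summand≡0 j _ with j ≤? t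
    ... | no  j≰t = trans (cong (ext X (suc i ∸ j) ⊗_) (ext-vanishes Y≡0 j (≰⇒> j≰t)))
                          (⊗𝟎 _)
    ... | yes j≤t = trans (cong (_⊗ ext Y j) (ext-vanishes X≡0 (suc i ∸ j) 1+s≤1+i∸j))
                          (𝟎⊗ _)
      where
      1+s≤1+i∸j : suc s ℕ.≤ suc i ∸ j
      1+s≤1+i∸j = m+n≤o⇒m≤o∸n (suc s) (s≤s (≤-trans (+-monoʳ-≤ s j≤t) s+t≤i))

  +ˢ-summand-𝟏 : ∀ X Y i a b → a + b ≡ suc i → ext X a ≡ 𝟏 → ext Y b ≡ 𝟏 →
                 (X +ˢ Y) i ≡ 𝟏
  +ˢ-summand-𝟏 X Y i a b a+b≡1+i Xa≡1 Yb≡1 =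
    sumUpTo-𝟏 _ (suc i) b (subst (b ℕ.≤_) a+b≡1+i (m≤n+m b a)) summand≡1
    where
    1+i∸b≡a : suc i ∸ b ≡ a
    1+i∸b≡a = trans (cong (_∸ b) (sym a+b≡1+i)) (m+n∸n≡m a b)

    summand≡1 : ext X (suc i ∸ b) ⊗ ext Y b ≡ 𝟏
    summand≡1 = begin
      ext X (suc i ∸ b) ⊗ ext Y b  ≡⟨ cong₂ (λ m y → ext X m ⊗ y) 1+i∸b≡a Yb≡1 ⟩
      ext X a ⊗ 𝟏                  ≡⟨ cong (_⊗ 𝟏) Xa≡1 ⟩
      𝟏 ⊗ 𝟏                        ≡⟨ identityˡ 𝟏 ⟩
      𝟏                            ∎
      where open ≡-Reasoning

  +ˢ-oneˡ : ∀ {X n} Y → OneBelow X n → OneBelow (X +ˢ Y) n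
  +ˢ-oneˡ {X} Y X≡1 i i<n = +ˢ-summand-𝟏 X Y i (suc i) 0 (+-identityʳ (suc i)) (X≡1 i i<n) refl

  +ˢ-oneʳ : ∀ {Y n} X → OneBelow Y n → OneBelow (X +ˢ Y) n
  +ˢ-oneʳ {Y} X Y≡1 i i<n = +ˢ-summand-𝟏 X Y i 0 (suc i) refl refl (Y≡1 i i<n)

  multiple-u-positive : ∀ n → OneBelow (proj₁ (suc n ·ᴾ u)) (suc n)
  multiple-u-positive zero    zero    _           = refl
  multiple-u-positive zero    (suc i) (s≤s ())
  multiple-u-positive (suc n) i (s≤s i≤1+n) with m≤n⇒m<n∨m≡n i≤1+n
  ... | inj₁ i<1+n = +ˢ-oneˡ oneˢ (multiple-u-positive n) i i<1+n
  ... | inj₂ refl  = +ˢ-summand-𝟏 (proj₁ (suc n ·ᴾ u)) oneˢ (suc n) (suc n) 1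
                       (cong suc (+-comm n 1)) (multiple-u-positive n n ≤-refl) refl

  multiple-u-negative : ∀ n → VanishesFrom (proj₂ (n ·ᴾ u)) 0
  multiple-u-negative zero          = zeroˢ-vanishes
  multiple-u-negative (suc zero)    = zeroˢ-vanishes
  multiple-u-negative (suc (suc n)) = +ˢ-vanishes (multiple-u-negative (suc n)) zeroˢ-vanishes

  zeroGood : GoodSeq
  zeroGood = goodSeq zeroˢ (λ _ → 𝟎⊕𝟎) (0 , zeroˢ-vanishes)

  u-nonnegative : 0ᴳ ≼ u
  u-nonnegative = zeroGood , vanishing≤ˢone {n = 0} lhs-vanishes (λ _ ()) z≤n
    where
    lhs-vanishes : VanishesFrom ((zeroˢ +ˢ zeroˢ) +ˢ zeroˢ) 0
    lhs-vanishes = +ˢ-vanishes (+ˢ-vanishes zeroˢ-vanishes zeroˢ-vanishes) zeroˢ-vanishes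

  u-dominates : ∀ (x : G) → ∃ λ n → (1 ℕ.≤ n) × (⌊ x ⌋ ≼ (n ·ᴾ u))
  u-dominates (a , b) with fin a
  ... | r , a≡0 = suc r , s≤s z≤n , zeroGood , vanishing≤ˢone lhs-vanishes rhs-one r+0+0≤1+r
    where
    n·u = suc r ·ᴾ u

    lhs-vanishes : VanishesFrom ((seq a +ˢ proj₂ n·u) +ˢ zeroˢ) (r + 0 + 0)
    lhs-vanishes = +ˢ-vanishes (+ˢ-vanishes a≡0 (multiple-u-negative (suc r))) zeroˢ-vanishes

    rhs-one : OneBelow ((seq b +ˢ proj₁ n·u) +ˢ zeroˢ) (suc r)
    rhs-one = +ˢ-oneˡ zeroˢ (+ˢ-oneʳ (seq b) (multiple-u-positive r))

    r+0+0≤1+r : r + 0 + 0 ℕ.≤ suc r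
    r+0+0≤1+r = ≤-trans (≤-reflexive (trans (+-identityʳ _) (+-identityʳ r))) (n≤1+n r)

proposition5p6 : ∀ {c : Level} (L : BLAlgebra c) → Chang.IsStrongUnit L (Chang.u L)
proposition5p6 L = StrongUnit.u-nonnegative L , StrongUnit.u-dominates L
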